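{- Let $G$ be a finite graph and let $M=\{(v_1,w_1),\ldots,(v_k,w_k)\}$ be an induced matching in $G$ with a dominating transversal $\sigma$. Then $\alpha_M$ is a nonzero class in $\widetilde{H}_{k-1}(I(G);\mathbb{Q})$, $\sigma^\vee$ is a nonzero class in $\widetilde{H}^{k-1}(I(G);\mathbb{Q})$, and $\langle\sigma^\vee,\alpha_M\rangle=\pm 1$.
   Context: $I(G)$ is the independence complex of $G$: the simplicial complex on $V(G)$ whose faces are the independent sets of $G$. All (co)homology is reduced, with rational coefficients, and $\langle\cdot,\cdot\rangle:\widetilde{H}^i\otimes\widetilde{H}_i\to\mathbb{Q}$ is the evaluation pairing. An induced matching of size $k$ is a set of $k$ pairwise disjoint edges of $G$ such that any two vertices from distinct edges are non-adjacent in $G$. A transversal of $M$ is a set of vertices containing exactly one endpoint of each edge of $M$; it is dominating if $N[\sigma]=V(G)$, where $N[\sigma]$ is the set of vertices in $\sigma$ or adjacent to a vertex of $\sigma$. Since $M$ is induced, $I(M)\cong S^{k-1}$ embeds in $I(G)$, and $\alpha_M$ denotes the image of its fundamental class, represented by the cycle $([v_1]-[w_1])\wedge\cdots\wedge([v_k]-[w_k])$. For a maximal independent set $\sigma$ of size $k$, $\sigma^\vee$ denotes the cocycle in degree $k-1$ taking value $\pm1$ on the two orientations of $\sigma$ and $0$ on all other simplices (and its cohomology class). -}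

module Defs where

open import Data.Bool using (Bool; true; false; if_then_else_)
open import Data.Nat using (ℕ; zero; suc; _<ᵇ_)
import Data.Fin
import Data.Bool
open import Data.Fin using (Fin; toℕ)
open import Data.Fin.Subset using (Subset; _∈_; _∉_; _∩_; _∪_; _-_; ⁅_⁆; ∣_∣; inside; outside)
open import Data.Vec using (Vec; []; _∷_; lookup; tabulate)
open import Data.Product using (_×_; _,_; proj₁; proj₂; ∃; Σ)
open import Data.Sum using (_⊎_)
open import Data.Empty using (⊥)
open import Relation.Nullary using (¬_)
open import Relation.Binary.PropositionalEquality using (_≡_; _≢_)
open import Data.Rational using (ℚ; 0ℚ; 1ℚ; -_; _+_; _*_)

record Graph (n : ℕ) : Set₁ where
  field
    Adj    : Fin n → Fin n → Set
    sym    : ∀ {x y} → Adj x y → Adj y x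
    irrefl : ∀ {x} → ¬ Adj x x
open Graph public

-- faces of the independence complex I(G)
Independent : ∀ {n} → Graph n → Subset n → Set
Independent G S = ∀ x y → x ∈ S → y ∈ S → ¬ Adj G x y

endpoint : ∀ {n k} → Vec (Fin n × Fin n) k → Fin k → Bool → Fin n
endpoint M i true  = proj₁ (lookup M i)
endpoint M i false = proj₂ (lookup M i)

IsInducedMatching : ∀ {n k} → Graph n → Vec (Fin n × Fin n) k → Set
IsInducedMatching G M =
    (∀ i → Adj G (proj₁ (lookup M i)) (proj₂ (lookup M i)))
  × (∀ i j b c → endpoint M i b ≡ endpoint M j c → (i ≡ j × b ≡ c))
  × (∀ i j b c → i ≢ j → ¬ Adj G (endpoint M i b) (endpoint M j c))

IsTransversal : ∀ {n k} → Vec (Fin n × Fin n) k → Subset n → Set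
IsTransversal M σ =
    (∀ i → (proj₁ (lookup M i) ∈ σ × proj₂ (lookup M i) ∉ σ)
         ⊎ (proj₁ (lookup M i) ∉ σ × proj₂ (lookup M i) ∈ σ))
  × (∀ x → x ∈ σ → ∃ λ i → ∃ λ b → endpoint M i b ≡ x)

IsDominating : ∀ {n} → Graph n → Subset n → Set
IsDominating G σ = ∀ x → x ∈ σ ⊎ (∃ λ y → y ∈ σ × Adj G x y)

-- A simplex is a subset S of Fin n (the empty set is the (-1)-simplex,
-- which gives *reduced* (co)homology), oriented by the increasing order
-- of Fin n.  A chain/cochain is a function Subset n → ℚ; a simplex of
-- size d+1 has dimension d.

Chain : ℕ → Set
Chain n = Subset n → ℚ

sgn : ℕ → ℚ
sgn zero    = 1ℚ
sgn (suc m) = - sgn m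

below : ∀ {n} → Subset n → Fin n → ℕ
below S v = ∣ S ∩ tabulate (λ u → toℕ u <ᵇ toℕ v) ∣

Σfin : ∀ n → (Fin n → ℚ) → ℚ
Σfin zero    f = 0ℚ
Σfin (suc n) f = f Data.Fin.zero + Σfin n (λ i → f (Data.Fin.suc i))


Σsub : ∀ n → (Subset n → ℚ) → ℚ
Σsub zero    f = f []
Σsub (suc n) f = Σsub n (λ S → f (inside ∷ S)) + Σsub n (λ S → f (outside ∷ S))

∂ : ∀ {n} → Chain n → Chain n
∂ {n} c τ = Σfin n (λ v → if lookup τ v then 0ℚ else sgn (below τ v) * c (τ ∪ ⁅ v ⁆))

δ : ∀ {n} → Chain n → Chain n
δ {n} f ρ = Σfin n (λ v → if lookup ρ v then sgn (below ρ v) * f (ρ - v) else 0ℚ)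

⟨_,_⟩ : ∀ {n} → Chain n → Chain n → ℚ
⟨_,_⟩ {n} f c = Σsub n (λ S → f S * c S)

-- Degrees are indexed by simplex SIZE s (dimension s-1), so that degree k-1
-- needs no truncated subtraction.
-- c is a chain of I(G) of dimension s-1 (supported on independent sets of size s)
IsChainOf : ∀ {n} → Graph n → ℕ → Chain n → Set
IsChainOf G s c = ∀ S → c S ≢ 0ℚ → Independent G S × ∣ S ∣ ≡ s

IsCycle : ∀ {n} → Chain n → Set
IsCycle c = ∀ τ → ∂ c τ ≡ 0ℚ

IsBoundaryIn : ∀ {n} → Graph n → ℕ → Chain n → Set
IsBoundaryIn G s c = Σ (Chain _) λ β → IsChainOf G (suc s) β × (∀ τ → ∂ β τ ≡ c τ)

IsCocycleIn : ∀ {n} → Graph n → ℕ → Chain n → Set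
IsCocycleIn G s f = ∀ ρ → Independent G ρ → ∣ ρ ∣ ≡ suc s → δ f ρ ≡ 0ℚ

-- f (of dimension s-1) is a coboundary in I(G) (as cochains on I(G), i.e.
-- agreeing on the independent sets of size s)
IsCoboundaryIn : ∀ {n} → Graph n → ℕ → Chain n → Set
IsCoboundaryIn G s f = Σ (Chain _) λ g →
  ∀ ρ → Independent G ρ → ∣ ρ ∣ ≡ s → δ g ρ ≡ f ρ

-- α_M = ([v₁]-[w₁]) ∧ ⋯ ∧ ([v_k]-[w_k]), using [x] ∧ [T] = (-1)^{#{u∈T : u<x}} [T ∪ {x}]

[_]∧_ : ∀ {n} → Fin n → Chain n → Chain n
([ x ]∧ c) S = if lookup S x then sgn (below S x) * c (S - x) else 0ℚ

emptySimplex : ∀ {n} → Chain n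
emptySimplex {zero}  []      = 1ℚ
emptySimplex {suc n} (b ∷ S) = if b then 0ℚ else emptySimplex S

α : ∀ {n k} → Vec (Fin n × Fin n) k → Chain n
α []             = emptySimplex
α ((v , w) ∷ M) S = ([ v ]∧ α M) S + - ([ w ]∧ α M) S

indicator : ∀ {n} → Subset n → Chain n
indicator {zero}  []      []      = 1ℚ
indicator {suc n} (b ∷ σ) (c ∷ S) = if b Data.Bool.xor c then 0ℚ else indicator σ S

_^∨ : ∀ {n} → Subset n → Chain n
σ ^∨ = indicator σ

module Submission where

-- Chains on Fin (suc n) are analysed by splitting off vertex 0: every
-- operator (∂, δ, [x]∧_) is expressed through the chains of simplices that
-- contain, resp. avoid, vertex 0.  By induction on n this gives
--   * the Leibniz rule ∂([x]∧c) = c − [x]∧∂c, hence α_M is a cycle;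
--   * adjointness ⟨f, ∂c⟩ = ⟨δf, c⟩, and ⟨σ^∨, c⟩ = c(σ).
-- By induction on the matching, α_M is supported on independent k-sets of
-- endpoints of M (M is induced) and is ±1 on every transversal.  Domination
-- makes σ^∨ a cocycle of I(G): (δσ^∨)(ρ) ≠ 0 would need ρ = σ ∪ {v} with v ∉ σ,
-- but v has a neighbour in σ.  Finally, a cocycle and a cycle of I(G) with
-- nonzero pairing are both nontrivial, and ⟨σ^∨, α_M⟩ = α_M(σ) = ±1.

open import Defs hiding (sym)
open import Data.Nat using (zero; suc)
open import Data.Bool using (Bool; true; false; not; if_then_else_) renaming (_≟_ to _≟ᵇ_)
open import Data.Bool.Properties using (¬-not)
open import Data.Fin using (Fin) renaming (zero to fz; suc to fs)
open import Data.Fin.Properties using (suc-injective) renaming (_≟_ to _≟ᶠ_)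
open import Data.Fin.Subset using (Subset; _∈_; _∉_; ∣_∣; _∩_; _∪_; _-_; ⁅_⁆; ⊥)
open import Data.Fin.Subset.Properties
  using (p─⊥≡p; ∪-identityʳ; ∉⊥; ∣⊥∣≡0; p─q⊆p; x∈p∧x≢y⇒x∈p-y)
open import Data.Vec using (Vec; []; _∷_; lookup; tabulate; here; there)
open import Data.Vec.Properties using ([]=⇒lookup; lookup⇒[]=)
open import Data.Product using (_×_; _,_; proj₁; proj₂; ∃)
open import Data.Sum using (_⊎_; inj₁; inj₂)
open import Data.Empty using (⊥-elim)
open import Function using (_∘_)
open import Relation.Nullary using (¬_; yes; no)
open import Relation.Binary.PropositionalEquality hiding ([_])
open ≡-Reasoning
open import Data.Rational using (ℚ; 0ℚ; 1ℚ; -_; _+_; _*_)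
open import Data.Rational.Properties
  using ( +-identityˡ; +-identityʳ; +-inverseʳ; *-identityˡ; *-zeroˡ; *-zeroʳ
        ; *-distribˡ-+; *-distribʳ-+; neg-distribˡ-*; neg-distribʳ-*; neg-distrib-+ )
  renaming (_≟_ to _≟ℚ_)
open import Data.Rational.Solver using (module +-*-Solver)
open +-*-Solver using (solve; _:+_; :-_; _:=_)

+-interchange : ∀ a b c d → (a + b) + (c + d) ≡ (a + c) + (b + d)
+-interchange = solve 4 (λ a b c d → (a :+ b) :+ (c :+ d) := (a :+ c) :+ (b :+ d)) refl

-b≡a-[a+b] : ∀ a b → - b ≡ a + - (a + b)
-b≡a-[a+b] = solve 2 (λ a b → :- b := a :+ :- (a :+ b)) refl

-a+[c-b]≡c-[a+b] : ∀ a b c → - a + (c + - b) ≡ c + - (a + b)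
-a+[c-b]≡c-[a+b] = solve 3 (λ a b c → :- a :+ (c :+ :- b) := c :+ :- (a :+ b)) refl

neg²[a-b]≡a-neg³b : ∀ a b → - - (a + - b) ≡ a + - - - b
neg²[a-b]≡a-neg³b = solve 2 (λ a b → :- :- (a :+ :- b) := a :+ :- :- :- b) refl

-x+[y+z]≡[y-x]+z : ∀ x y z → - x + (y + z) ≡ (y + - x) + z
-x+[y+z]≡[y-x]+z = solve 3 (λ x y z → :- x :+ (y :+ z) := (y :+ :- x) :+ z) refl

Σfin-cong : ∀ n {f g : Fin n → ℚ} → (∀ i → f i ≡ g i) → Σfin n f ≡ Σfin n g
Σfin-cong zero    eq = refl
Σfin-cong (suc n) eq = cong₂ _+_ (eq fz) (Σfin-cong n (λ i → eq (fs i)))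

Σfin-neg : ∀ n (f : Fin n → ℚ) → Σfin n (λ i → - f i) ≡ - Σfin n f
Σfin-neg zero    f = refl
Σfin-neg (suc n) f =
  trans (cong (- f fz +_) (Σfin-neg n (λ i → f (fs i)))) (sym (neg-distrib-+ (f fz) (Σfin n (λ i → f (fs i)))))

Σfin-+ : ∀ n (f g : Fin n → ℚ) → Σfin n (λ i → f i + g i) ≡ Σfin n f + Σfin n g
Σfin-+ zero    f g = refl
Σfin-+ (suc n) f g =
  trans (cong (f fz + g fz +_) (Σfin-+ n (λ i → f (fs i)) (λ i → g (fs i))))
        (+-interchange (f fz) (g fz) _ _)

Σfin-zero : ∀ n (f : Fin n → ℚ) → (∀ i → f i ≡ 0ℚ) → Σfin n f ≡ 0ℚ
Σfin-zero zero    f eq = refl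
Σfin-zero (suc n) f eq =
  trans (cong₂ _+_ (eq fz) (Σfin-zero n _ (λ i → eq (fs i)))) (+-identityˡ 0ℚ)

Σsub-cong : ∀ n {f g : Subset n → ℚ} → (∀ S → f S ≡ g S) → Σsub n f ≡ Σsub n g
Σsub-cong zero    eq = eq []
Σsub-cong (suc n) eq =
  cong₂ _+_ (Σsub-cong n (λ S → eq (true ∷ S))) (Σsub-cong n (λ S → eq (false ∷ S)))

Σsub-neg : ∀ n (f : Subset n → ℚ) → Σsub n (λ S → - f S) ≡ - Σsub n f
Σsub-neg zero    f = refl
Σsub-neg (suc n) f =
  trans (cong₂ _+_ (Σsub-neg n (f ∘ (true ∷_))) (Σsub-neg n (f ∘ (false ∷_))))
        (sym (neg-distrib-+ (Σsub n (f ∘ (true ∷_))) (Σsub n (f ∘ (false ∷_)))))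

Σsub-+ : ∀ n (f g : Subset n → ℚ) → Σsub n (λ S → f S + g S) ≡ Σsub n f + Σsub n g
Σsub-+ zero    f g = refl
Σsub-+ (suc n) f g =
  trans (cong₂ _+_ (Σsub-+ n (λ S → f (true ∷ S)) (λ S → g (true ∷ S)))
                   (Σsub-+ n (λ S → f (false ∷ S)) (λ S → g (false ∷ S))))
        (+-interchange (Σsub n (f ∘ (true ∷_))) (Σsub n (g ∘ (true ∷_))) _ _)

Σsub-zero : ∀ n (f : Subset n → ℚ) → (∀ S → f S ≡ 0ℚ) → Σsub n f ≡ 0ℚ
Σsub-zero zero    f eq = eq []
Σsub-zero (suc n) f eq =
  trans (cong₂ _+_ (Σsub-zero n _ (λ S → eq (true ∷ S))) (Σsub-zero n _ (λ S → eq (false ∷ S))))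
        (+-identityˡ 0ℚ)

-- A summand of ∂ is a scaling s·x switched off when the vertex is already in
-- the simplex; a summand of δ or of [x]∧_ is one switched on.  Both are linear.

gateOff gateOn : Bool → ℚ → ℚ → ℚ
gateOff b s x = if b then 0ℚ else s * x
gateOn  b s x = if b then s * x else 0ℚ

gateOff-negˢ : ∀ b s x → gateOff b (- s) x ≡ - gateOff b s x
gateOff-negˢ true  s x = refl
gateOff-negˢ false s x = sym (neg-distribˡ-* s x)

gateOff-neg : ∀ b s x → gateOff b s (- x) ≡ - gateOff b s x
gateOff-neg true  s x = refl
gateOff-neg false s x = sym (neg-distribʳ-* s x)

gateOff-+ : ∀ b s x y → gateOff b s (x + y) ≡ gateOff b s x + gateOff b s y
gateOff-+ true  s x y = refl
gateOff-+ false s x y = *-distribˡ-+ s x y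

gateOff-zero : ∀ b s → gateOff b s 0ℚ ≡ 0ℚ
gateOff-zero true  s = refl
gateOff-zero false s = *-zeroʳ s

gateOn-negˢ : ∀ b s x → gateOn b (- s) x ≡ - gateOn b s x
gateOn-negˢ true  s x = sym (neg-distribˡ-* s x)
gateOn-negˢ false s x = refl

gateOn-neg : ∀ b s x → gateOn b s (- x) ≡ - gateOn b s x
gateOn-neg true  s x = sym (neg-distribʳ-* s x)
gateOn-neg false s x = refl

gateOn-+ : ∀ b s x y → gateOn b s (x + y) ≡ gateOn b s x + gateOn b s y
gateOn-+ true  s x y = *-distribˡ-+ s x y
gateOn-+ false s x y = refl

gateOn-zero : ∀ b s → gateOn b s 0ℚ ≡ 0ℚ
gateOn-zero true  s = *-zeroʳ s
gateOn-zero false s = refl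

∂-cong : ∀ {n} {c d : Chain n} → (∀ S → c S ≡ d S) → ∀ τ → ∂ c τ ≡ ∂ d τ
∂-cong {n} {c} eq τ =
  Σfin-cong n (λ v → cong (gateOff (lookup τ v) (sgn (below τ v))) (eq (τ ∪ ⁅ v ⁆)))

∂-zero : ∀ {n} (c : Chain n) → (∀ S → c S ≡ 0ℚ) → ∀ τ → ∂ c τ ≡ 0ℚ
∂-zero {n} c eq τ = Σfin-zero n _ λ v →
  trans (cong (gateOff (lookup τ v) (sgn (below τ v))) (eq (τ ∪ ⁅ v ⁆)))
        (gateOff-zero (lookup τ v) (sgn (below τ v)))

∂-neg : ∀ {n} (c : Chain n) τ → ∂ (λ S → - c S) τ ≡ - ∂ c τ
∂-neg {n} c τ =
  trans (Σfin-cong n (λ v → gateOff-neg (lookup τ v) (sgn (below τ v)) (c (τ ∪ ⁅ v ⁆))))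
        (Σfin-neg n _)

∂-+ : ∀ {n} (c d : Chain n) τ → ∂ (λ S → c S + d S) τ ≡ ∂ c τ + ∂ d τ
∂-+ {n} c d τ =
  trans (Σfin-cong n (λ v → gateOff-+ (lookup τ v) (sgn (below τ v)) (c (τ ∪ ⁅ v ⁆)) (d (τ ∪ ⁅ v ⁆))))
        (Σfin-+ n _ _)

∧-cong : ∀ {n} x {c d : Chain n} → (∀ S → c S ≡ d S) → ∀ S → ([ x ]∧ c) S ≡ ([ x ]∧ d) S
∧-cong x eq S = cong (gateOn (lookup S x) (sgn (below S x))) (eq (S - x))

∧-zero : ∀ {n} x (c : Chain n) → (∀ S → c S ≡ 0ℚ) → ∀ S → ([ x ]∧ c) S ≡ 0ℚ
∧-zero x c eq S = trans (∧-cong x eq S) (gateOn-zero (lookup S x) (sgn (below S x)))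

∧-neg : ∀ {n} x (c : Chain n) S → ([ x ]∧ (λ T → - c T)) S ≡ - ([ x ]∧ c) S
∧-neg x c S = gateOn-neg (lookup S x) (sgn (below S x)) (c (S - x))

∧-+ : ∀ {n} x (c d : Chain n) S → ([ x ]∧ (λ T → c T + d T)) S ≡ ([ x ]∧ c) S + ([ x ]∧ d) S
∧-+ x c d S = gateOn-+ (lookup S x) (sgn (below S x)) (c (S - x)) (d (S - x))

_⁺ _⁻ : ∀ {n} → Chain (suc n) → Chain n
(c ⁺) S = c (true ∷ S)
(c ⁻) S = c (false ∷ S)

∣∩∅∣≡0 : ∀ {n} (τ : Subset n) → ∣ τ ∩ tabulate (λ _ → false) ∣ ≡ 0
∣∩∅∣≡0 []          = refl
∣∩∅∣≡0 (false ∷ τ) = ∣∩∅∣≡0 τ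
∣∩∅∣≡0 (true ∷ τ)  = ∣∩∅∣≡0 τ

below-zero : ∀ {n} b (τ : Subset n) → below (b ∷ τ) fz ≡ 0
below-zero false τ = ∣∩∅∣≡0 τ
below-zero true  τ = ∣∩∅∣≡0 τ

remove-zero : ∀ {n} b (S : Subset n) → (b ∷ S) - fz ≡ false ∷ S
remove-zero b S = cong (false ∷_) (p─⊥≡p S)

-- The operators in terms of the split.  In addition, by computation,
-- ([ 0 ]∧ c) (false ∷ S) = 0 and ([ suc y ]∧ c) ⁻ = [ y ]∧ (c ⁻).

∂-peel-out : ∀ {n} (c : Chain (suc n)) τ → ∂ c (false ∷ τ) ≡ c (true ∷ τ) + ∂ (c ⁻) τ
∂-peel-out c τ = cong (_+ ∂ (c ⁻) τ)
  (trans (cong₂ (λ m T → sgn m * c (true ∷ T)) (below-zero false τ) (∪-identityʳ τ))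
         (*-identityˡ (c (true ∷ τ))))

∂-peel-in : ∀ {n} (c : Chain (suc n)) τ → ∂ c (true ∷ τ) ≡ - ∂ (c ⁺) τ
∂-peel-in {n} c τ =
  trans (+-identityˡ _)
  (trans (Σfin-cong n (λ v → gateOff-negˢ (lookup τ v) (sgn (below τ v)) ((c ⁺) (τ ∪ ⁅ v ⁆))))
         (Σfin-neg n _))

δ-peel-out : ∀ {n} (f : Chain (suc n)) ρ → δ f (false ∷ ρ) ≡ δ (f ⁻) ρ
δ-peel-out f ρ = +-identityˡ _

δ-peel-in : ∀ {n} (f : Chain (suc n)) ρ → δ f (true ∷ ρ) ≡ f (false ∷ ρ) + - δ (f ⁺) ρ
δ-peel-in {n} f ρ = cong₂ _+_
  (trans (cong₂ (λ m T → sgn m * f T) (below-zero true ρ) (remove-zero true ρ))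
         (*-identityˡ (f (false ∷ ρ))))
  (trans (Σfin-cong n (λ v → gateOn-negˢ (lookup ρ v) (sgn (below ρ v)) ((f ⁺) (ρ - v))))
         (Σfin-neg n _))

∧-zero-in : ∀ {n} (c : Chain (suc n)) S → ([ fz ]∧ c) (true ∷ S) ≡ c (false ∷ S)
∧-zero-in c S =
  trans (cong₂ (λ m T → sgn m * c T) (below-zero true S) (remove-zero true S))
        (*-identityˡ (c (false ∷ S)))

∧-suc-in : ∀ {n} (c : Chain (suc n)) y S → ([ fs y ]∧ c) (true ∷ S) ≡ - ([ y ]∧ (c ⁺)) S
∧-suc-in c y S = gateOn-negˢ (lookup S y) (sgn (below S y)) ((c ⁺) (S - y))

leibniz : ∀ {n} (x : Fin n) (c : Chain n) τ → ∂ ([ x ]∧ c) τ ≡ c τ + - ([ x ]∧ ∂ c) τ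
leibniz {suc n} fz c (false ∷ τ) = begin
  ∂ ([ fz ]∧ c) (false ∷ τ)                     ≡⟨ ∂-peel-out ([ fz ]∧ c) τ ⟩
  ([ fz ]∧ c) (true ∷ τ) + ∂ (([ fz ]∧ c) ⁻) τ  ≡⟨ cong₂ _+_ (∧-zero-in c τ) (∂-zero _ (λ _ → refl) τ) ⟩
  c (false ∷ τ) + 0ℚ                            ∎
leibniz {suc n} fz c (true ∷ τ) = begin
  ∂ ([ fz ]∧ c) (true ∷ τ)                      ≡⟨ ∂-peel-in ([ fz ]∧ c) τ ⟩
  - ∂ (([ fz ]∧ c) ⁺) τ                         ≡⟨ cong -_ (∂-cong (∧-zero-in c) τ) ⟩
  - ∂ (c ⁻) τ                                   ≡⟨ -b≡a-[a+b] (c (true ∷ τ)) (∂ (c ⁻) τ) ⟩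
  c (true ∷ τ) + - (c (true ∷ τ) + ∂ (c ⁻) τ)   ≡⟨ cong (λ z → c (true ∷ τ) + - z) (sym (∂-peel-out c τ)) ⟩
  c (true ∷ τ) + - ∂ c (false ∷ τ)              ≡⟨ cong (λ z → c (true ∷ τ) + - z) (sym (∧-zero-in (∂ c) τ)) ⟩
  c (true ∷ τ) + - ([ fz ]∧ ∂ c) (true ∷ τ)     ∎
leibniz {suc n} (fs y) c (false ∷ τ) = begin
  ∂ ([ fs y ]∧ c) (false ∷ τ)                      ≡⟨ ∂-peel-out ([ fs y ]∧ c) τ ⟩
  ([ fs y ]∧ c) (true ∷ τ) + ∂ ([ y ]∧ (c ⁻)) τ    ≡⟨ cong₂ _+_ (∧-suc-in c y τ) (leibniz y (c ⁻) τ) ⟩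
  - a + (c (false ∷ τ) + - b)                      ≡⟨ -a+[c-b]≡c-[a+b] a b (c (false ∷ τ)) ⟩
  c (false ∷ τ) + - (a + b)                        ≡⟨ cong (λ z → c (false ∷ τ) + - z) (sym (∧-+ y (c ⁺) (∂ (c ⁻)) τ)) ⟩
  c (false ∷ τ) + - ([ y ]∧ (λ S → c (true ∷ S) + ∂ (c ⁻) S)) τ
    ≡⟨ cong (λ z → c (false ∷ τ) + - z) (∧-cong y (λ S → sym (∂-peel-out c S)) τ) ⟩
  c (false ∷ τ) + - ([ fs y ]∧ ∂ c) (false ∷ τ)    ∎
  where
  a b : ℚ
  a = ([ y ]∧ (c ⁺)) τ
  b = ([ y ]∧ ∂ (c ⁻)) τ
leibniz {suc n} (fs y) c (true ∷ τ) = begin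
  ∂ ([ fs y ]∧ c) (true ∷ τ)                       ≡⟨ ∂-peel-in ([ fs y ]∧ c) τ ⟩
  - ∂ (([ fs y ]∧ c) ⁺) τ                          ≡⟨ cong -_ (∂-cong (∧-suc-in c y) τ) ⟩
  - ∂ (λ S → - ([ y ]∧ (c ⁺)) S) τ                 ≡⟨ cong -_ (∂-neg ([ y ]∧ (c ⁺)) τ) ⟩
  - - ∂ ([ y ]∧ (c ⁺)) τ                           ≡⟨ cong (λ z → - - z) (leibniz y (c ⁺) τ) ⟩
  - - (c (true ∷ τ) + - b)                         ≡⟨ neg²[a-b]≡a-neg³b (c (true ∷ τ)) b ⟩
  c (true ∷ τ) + - - - b                           ≡⟨ cong (λ z → c (true ∷ τ) + - - z) (sym (∧-neg y (∂ (c ⁺)) τ)) ⟩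
  c (true ∷ τ) + - - ([ y ]∧ (λ S → - ∂ (c ⁺) S)) τ
    ≡⟨ cong (λ z → c (true ∷ τ) + - - z) (∧-cong y (λ S → sym (∂-peel-in c S)) τ) ⟩
  c (true ∷ τ) + - - ([ y ]∧ (∂ c ⁺)) τ            ≡⟨ cong (λ z → c (true ∷ τ) + - z) (sym (∧-suc-in (∂ c) y τ)) ⟩
  c (true ∷ τ) + - ([ fs y ]∧ ∂ c) (true ∷ τ)      ∎
  where
  b : ℚ
  b = ([ y ]∧ ∂ (c ⁺)) τ

-- α_M is a cycle: the empty simplex is one, and by the Leibniz rule wedging a
-- cycle z with [v] − [w] gives ∂ = (z − [v]∧∂z) − (z − [w]∧∂z) = 0.

∂-emptySimplex : ∀ {n} τ → ∂ (emptySimplex {n}) τ ≡ 0ℚ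
∂-emptySimplex {zero}  []          = refl
∂-emptySimplex {suc n} (false ∷ τ) =
  trans (∂-peel-out emptySimplex τ) (trans (+-identityˡ _) (∂-emptySimplex τ))
∂-emptySimplex {suc n} (true ∷ τ)  =
  trans (∂-peel-in emptySimplex τ) (cong -_ (∂-zero _ (λ _ → refl) τ))

α-cycle : ∀ {n k} (M : Vec (Fin n × Fin n) k) → IsCycle (α M)
α-cycle []              τ = ∂-emptySimplex τ
α-cycle ((v , w) ∷ M) τ = begin
  ∂ (α ((v , w) ∷ M)) τ                               ≡⟨ ∂-+ ([ v ]∧ α M) (λ S → - ([ w ]∧ α M) S) τ ⟩
  ∂ ([ v ]∧ α M) τ + ∂ (λ S → - ([ w ]∧ α M) S) τ     ≡⟨ cong (∂ ([ v ]∧ α M) τ +_) (∂-neg ([ w ]∧ α M) τ) ⟩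
  ∂ ([ v ]∧ α M) τ + - ∂ ([ w ]∧ α M) τ               ≡⟨ cong₂ (λ p q → p + - q) (leibniz v (α M) τ) (leibniz w (α M) τ) ⟩
  (α M τ + - ([ v ]∧ ∂ (α M)) τ) + - (α M τ + - ([ w ]∧ ∂ (α M)) τ)
    ≡⟨ cong₂ (λ p q → (α M τ + - p) + - (α M τ + - q)) (∧-zero v _ (α-cycle M) τ) (∧-zero w _ (α-cycle M) τ) ⟩
  (α M τ + 0ℚ) + - (α M τ + 0ℚ)                       ≡⟨ +-inverseʳ (α M τ + 0ℚ) ⟩
  0ℚ                                                  ∎

pairing-congˡ : ∀ {n} {f g : Chain n} (c : Chain n) → (∀ S → f S ≡ g S) → ⟨ f , c ⟩ ≡ ⟨ g , c ⟩
pairing-congˡ {n} c f≡g = Σsub-cong n (λ S → cong (_* c S) (f≡g S))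

pairing-congʳ : ∀ {n} (f : Chain n) {c d : Chain n} → (∀ S → c S ≡ d S) → ⟨ f , c ⟩ ≡ ⟨ f , d ⟩
pairing-congʳ {n} f c≡d = Σsub-cong n (λ S → cong (f S *_) (c≡d S))

pairing-negˡ : ∀ {n} (f c : Chain n) → ⟨ (λ S → - f S) , c ⟩ ≡ - ⟨ f , c ⟩
pairing-negˡ {n} f c = trans (Σsub-cong n (λ S → sym (neg-distribˡ-* (f S) (c S)))) (Σsub-neg n _)

pairing-negʳ : ∀ {n} (f c : Chain n) → ⟨ f , (λ S → - c S) ⟩ ≡ - ⟨ f , c ⟩
pairing-negʳ {n} f c = trans (Σsub-cong n (λ S → sym (neg-distribʳ-* (f S) (c S)))) (Σsub-neg n _)

pairing-+ˡ : ∀ {n} (f g c : Chain n) → ⟨ (λ S → f S + g S) , c ⟩ ≡ ⟨ f , c ⟩ + ⟨ g , c ⟩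
pairing-+ˡ {n} f g c = trans (Σsub-cong n (λ S → *-distribʳ-+ (c S) (f S) (g S))) (Σsub-+ n _ _)

pairing-+ʳ : ∀ {n} (f c d : Chain n) → ⟨ f , (λ S → c S + d S) ⟩ ≡ ⟨ f , c ⟩ + ⟨ f , d ⟩
pairing-+ʳ {n} f c d = trans (Σsub-cong n (λ S → *-distribˡ-+ (f S) (c S) (d S))) (Σsub-+ n _ _)

pairing-zeroˡ : ∀ {n} (c : Chain n) → ⟨ (λ _ → 0ℚ) , c ⟩ ≡ 0ℚ
pairing-zeroˡ {n} c = Σsub-zero n _ (λ S → *-zeroˡ (c S))

pairing-zeroʳ : ∀ {n} (f : Chain n) → ⟨ f , (λ _ → 0ℚ) ⟩ ≡ 0ℚ
pairing-zeroʳ {n} f = Σsub-zero n _ (λ S → *-zeroʳ (f S))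

pairing-on-support : ∀ {n} (f g c : Chain n) → (∀ S → c S ≢ 0ℚ → f S ≡ g S) → ⟨ f , c ⟩ ≡ ⟨ g , c ⟩
pairing-on-support {n} f g c agree = Σsub-cong n term
  where
  term : ∀ S → f S * c S ≡ g S * c S
  term S with c S ≟ℚ 0ℚ
  ... | yes c≡0 = trans (cong (f S *_) c≡0) (trans (*-zeroʳ (f S)) (sym (trans (cong (g S *_) c≡0) (*-zeroʳ (g S)))))
  ... | no  c≢0 = cong (_* c S) (agree S c≢0)

-- ∂ and δ are adjoint: ⟨f, ∂c⟩ = ⟨δf, c⟩.  Splitting off vertex 0, with
-- X = ⟨δf⁺, c⁺⟩, Y = ⟨f⁻, c⁺⟩, Z = ⟨δf⁻, c⁻⟩ both sides equal (Y − X) + Z.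

adjoint : ∀ {n} (f c : Chain n) → ⟨ f , ∂ c ⟩ ≡ ⟨ δ f , c ⟩
adjoint {zero}  f c = trans (*-zeroʳ (f [])) (sym (*-zeroˡ (c [])))
adjoint {suc n} f c = begin
  ⟨ f ⁺ , ∂ c ⁺ ⟩ + ⟨ f ⁻ , ∂ c ⁻ ⟩        ≡⟨ cong₂ _+_ ∂-part⁺ ∂-part⁻ ⟩
  - X + (Y + Z)                          ≡⟨ -x+[y+z]≡[y-x]+z X Y Z ⟩
  (Y + - X) + Z                          ≡⟨ cong₂ _+_ (sym δ-part⁺) (sym δ-part⁻) ⟩
  ⟨ δ f ⁺ , c ⁺ ⟩ + ⟨ δ f ⁻ , c ⁻ ⟩      ∎
  where
  X Y Z : ℚ
  X = ⟨ δ (f ⁺) , c ⁺ ⟩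
  Y = ⟨ f ⁻ , c ⁺ ⟩
  Z = ⟨ δ (f ⁻) , c ⁻ ⟩
  ∂-part⁺ : ⟨ f ⁺ , ∂ c ⁺ ⟩ ≡ - X
  ∂-part⁺ = trans (pairing-congʳ (f ⁺) (∂-peel-in c))
            (trans (pairing-negʳ (f ⁺) (∂ (c ⁺))) (cong -_ (adjoint (f ⁺) (c ⁺))))
  ∂-part⁻ : ⟨ f ⁻ , ∂ c ⁻ ⟩ ≡ Y + Z
  ∂-part⁻ = trans (pairing-congʳ (f ⁻) (∂-peel-out c))
            (trans (pairing-+ʳ (f ⁻) (c ⁺) (∂ (c ⁻))) (cong (Y +_) (adjoint (f ⁻) (c ⁻))))
  δ-part⁺ : ⟨ δ f ⁺ , c ⁺ ⟩ ≡ Y + - X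
  δ-part⁺ = trans (pairing-congˡ (c ⁺) (δ-peel-in f))
            (trans (pairing-+ˡ (f ⁻) (λ S → - δ (f ⁺) S) (c ⁺)) (cong (Y +_) (pairing-negˡ (δ (f ⁺)) (c ⁺))))
  δ-part⁻ : ⟨ δ f ⁻ , c ⁻ ⟩ ≡ Z
  δ-part⁻ = pairing-congˡ (c ⁻) (δ-peel-out f)

indicator-pairing : ∀ {n} (σ : Subset n) (c : Chain n) → ⟨ σ ^∨ , c ⟩ ≡ c σ
indicator-pairing {zero}  []      c = *-identityˡ (c [])
indicator-pairing {suc n} (true ∷ σ) c =
  trans (cong₂ _+_ (indicator-pairing σ (c ⁺)) (pairing-zeroˡ (c ⁻))) (+-identityʳ _)
indicator-pairing {suc n} (false ∷ σ) c =
  trans (cong₂ _+_ (pairing-zeroˡ (c ⁺)) (indicator-pairing σ (c ⁻))) (+-identityˡ _)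

indicator-support : ∀ {n} (σ S : Subset n) → (σ ^∨) S ≢ 0ℚ → S ≡ σ
indicator-support []          []          ne = refl
indicator-support (true ∷ σ)  (true ∷ S)  ne = cong (true ∷_) (indicator-support σ S ne)
indicator-support (false ∷ σ) (false ∷ S) ne = cong (false ∷_) (indicator-support σ S ne)
indicator-support (true ∷ σ)  (false ∷ S) ne = ⊥-elim (ne refl)
indicator-support (false ∷ σ) (true ∷ S)  ne = ⊥-elim (ne refl)

-- A cocycle and a cycle of I(G) with nonzero pairing are both nontrivial:
-- ⟨f, ∂β⟩ = ⟨δf, β⟩ = 0 and ⟨δg, c⟩ = ⟨g, ∂c⟩ = 0.

¬boundary : ∀ {n} (G : Graph n) s (f c : Chain n) →
  IsCocycleIn G s f → ⟨ f , c ⟩ ≢ 0ℚ → ¬ IsBoundaryIn G s c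
¬boundary G s f c cocycle pairing≢0 (β , β-chain , ∂β≡c) = pairing≢0 (begin
  ⟨ f , c ⟩             ≡⟨ pairing-congʳ f (λ S → sym (∂β≡c S)) ⟩
  ⟨ f , ∂ β ⟩           ≡⟨ adjoint f β ⟩
  ⟨ δ f , β ⟩           ≡⟨ pairing-on-support (δ f) (λ _ → 0ℚ) β δf-vanishes ⟩
  ⟨ (λ _ → 0ℚ) , β ⟩    ≡⟨ pairing-zeroˡ β ⟩
  0ℚ                    ∎)
  where
  δf-vanishes : ∀ S → β S ≢ 0ℚ → δ f S ≡ 0ℚ
  δf-vanishes S β≢0 = let (independent , size) = β-chain S β≢0 in cocycle S independent size

¬coboundary : ∀ {n} (G : Graph n) s (f c : Chain n) →
  IsChainOf G s c → IsCycle c → ⟨ f , c ⟩ ≢ 0ℚ → ¬ IsCoboundaryIn G s f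
¬coboundary G s f c c-chain cycle pairing≢0 (g , δg≡f) = pairing≢0 (begin
  ⟨ f , c ⟩             ≡⟨ pairing-on-support f (δ g) c f≡δg ⟩
  ⟨ δ g , c ⟩           ≡⟨ sym (adjoint g c) ⟩
  ⟨ g , ∂ c ⟩           ≡⟨ pairing-congʳ g cycle ⟩
  ⟨ g , (λ _ → 0ℚ) ⟩    ≡⟨ pairing-zeroʳ g ⟩
  0ℚ                    ∎)
  where
  f≡δg : ∀ S → c S ≢ 0ℚ → f S ≡ δ g S
  f≡δg S c≢0 = let (independent , size) = c-chain S c≢0 in sym (δg≡f S independent size)

x∉p-x : ∀ {n} (S : Subset n) x → x ∉ S - x
x∉p-x (b ∷ S) fz     ()
x∉p-x (b ∷ S) (fs x) (there x∈) = x∉p-x S x x∈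

x∈p-y⇒x∈p : ∀ {n} {S : Subset n} {x y} → x ∈ S - y → x ∈ S
x∈p-y⇒x∈p {S = S} {y = y} = p─q⊆p S ⁅ y ⁆

∣p∣≡1+∣p-x∣ : ∀ {n} {S : Subset n} {x} → x ∈ S → ∣ S ∣ ≡ suc ∣ S - x ∣
∣p∣≡1+∣p-x∣ {S = true ∷ S} here        = cong (λ T → suc ∣ T ∣) (sym (p─⊥≡p S))
∣p∣≡1+∣p-x∣ {S = true ∷ S} (there x∈)  = cong suc (∣p∣≡1+∣p-x∣ x∈)
∣p∣≡1+∣p-x∣ {S = false ∷ S} (there x∈) = ∣p∣≡1+∣p-x∣ x∈

∉⇒lookup≡false : ∀ {n} {S : Subset n} {x} → x ∉ S → lookup S x ≡ false
∉⇒lookup≡false {S = S} {x} x∉S with lookup S x in eq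
... | true  = ⊥-elim (x∉S (lookup⇒[]= x S eq))
... | false = refl

wedge-in : ∀ {n} x (c : Chain n) {S} → x ∈ S → ([ x ]∧ c) S ≡ sgn (below S x) * c (S - x)
wedge-in x c {S} x∈S rewrite []=⇒lookup x∈S = refl

wedge-out : ∀ {n} x (c : Chain n) {S} → x ∉ S → ([ x ]∧ c) S ≡ 0ℚ
wedge-out x c {S} x∉S rewrite ∉⇒lookup≡false x∉S = refl

wedge-support : ∀ {n} x (c : Chain n) S → ([ x ]∧ c) S ≢ 0ℚ → x ∈ S × c (S - x) ≢ 0ℚ
wedge-support x c S ne with lookup S x in eq
... | false = ⊥-elim (ne refl)
... | true  = lookup⇒[]= x S eq , λ c≡0 → ne (trans (cong (sgn (below S x) *_) c≡0) (*-zeroʳ (sgn (below S x))))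

emptySimplex-support : ∀ {n} (S : Subset n) → emptySimplex S ≢ 0ℚ → S ≡ ⊥
emptySimplex-support []          ne = refl
emptySimplex-support (true ∷ S)  ne = ⊥-elim (ne refl)
emptySimplex-support (false ∷ S) ne = cong (false ∷_) (emptySimplex-support S ne)

emptySimplex-on-empty : ∀ {n} (S : Subset n) → (∀ x → x ∉ S) → emptySimplex S ≡ 1ℚ
emptySimplex-on-empty []          empty = refl
emptySimplex-on-empty (true ∷ S)  empty = ⊥-elim (empty fz here)
emptySimplex-on-empty (false ∷ S) empty = emptySimplex-on-empty S (λ x x∈ → empty (fs x) (there x∈))

DistinctEndpoints : ∀ {n k} → Vec (Fin n × Fin n) k → Set
DistinctEndpoints M = ∀ i j b c → endpoint M i b ≡ endpoint M j c → (i ≡ j × b ≡ c)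

endpoint-tail : ∀ {n k} e (M : Vec (Fin n × Fin n) k) i b → endpoint (e ∷ M) (fs i) b ≡ endpoint M i b
endpoint-tail e M i true  = refl
endpoint-tail e M i false = refl

distinct-tail : ∀ {n k} e (M : Vec (Fin n × Fin n) k) → DistinctEndpoints (e ∷ M) → DistinctEndpoints M
distinct-tail e M distinct i j b c eq =
  let (i≡j , b≡c) = distinct (fs i) (fs j) b c (trans (endpoint-tail e M i b) (trans eq (sym (endpoint-tail e M j c))))
  in suc-injective i≡j , b≡c

induced-tail : ∀ {n k} (G : Graph n) e (M : Vec (Fin n × Fin n) k) → IsInducedMatching G (e ∷ M) → IsInducedMatching G M
induced-tail G e M (edges , distinct , far) =
    (λ i → edges (fs i))
  , distinct-tail e M distinct
  , (λ i j b c i≢j → subst₂ (λ p q → ¬ Adj G p q) (endpoint-tail e M i b) (endpoint-tail e M j c)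
                             (far (fs i) (fs j) b c (λ eq → i≢j (suc-injective eq))))

-- The simplices on which α_M can be nonzero: independent k-sets of endpoints of M.

MatchingFace : ∀ {n k} → Graph n → Vec (Fin n × Fin n) k → Subset n → Set
MatchingFace {k = k} G M S =
  Independent G S × ∣ S ∣ ≡ k × (∀ x → x ∈ S → ∃ λ i → ∃ λ b → endpoint M i b ≡ x)

-- Adding an endpoint x of the first edge to a matching face of the remaining
-- matching gives a matching face: M is induced, so x is not adjacent to the
-- other endpoints.

extend-face : ∀ {n k} (G : Graph n) e (M : Vec (Fin n × Fin n) k) → IsInducedMatching G (e ∷ M) →
  ∀ S b → endpoint (e ∷ M) fz b ∈ S → MatchingFace G M (S - endpoint (e ∷ M) fz b) →
  MatchingFace G (e ∷ M) S
extend-face G e M (_ , _ , far) S b x∈S (independent , size , ends) =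
  independent′ , trans (∣p∣≡1+∣p-x∣ x∈S) (cong suc size) , ends′
  where
  x : Fin _
  x = endpoint (e ∷ M) fz b
  ends′ : ∀ y → y ∈ S → ∃ λ i → ∃ λ c → endpoint (e ∷ M) i c ≡ y
  ends′ y y∈S with y ≟ᶠ x
  ... | yes refl = fz , b , refl
  ... | no  y≢x  = let (i , c , eq) = ends y (x∈p∧x≢y⇒x∈p-y y∈S y≢x) in
                   fs i , c , trans (endpoint-tail e M i c) eq
  x-far : ∀ z → z ∈ S → z ≢ x → ¬ Adj G x z
  x-far z z∈S z≢x with ends z (x∈p∧x≢y⇒x∈p-y z∈S z≢x)
  ... | i , c , refl = subst (λ q → ¬ Adj G x q) (endpoint-tail e M i c) (far fz (fs i) b c (λ ()))
  independent′ : Independent G S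
  independent′ y z y∈S z∈S with y ≟ᶠ x | z ≟ᶠ x
  ... | yes refl | yes refl = irrefl G
  ... | yes refl | no  z≢x  = x-far z z∈S z≢x
  ... | no  y≢x  | yes refl = λ adj → x-far y y∈S y≢x (Graph.sym G adj)
  ... | no  y≢x  | no  z≢x  = independent y z (x∈p∧x≢y⇒x∈p-y y∈S y≢x) (x∈p∧x≢y⇒x∈p-y z∈S z≢x)

nonzero-difference : ∀ a b → a + - b ≢ 0ℚ → a ≢ 0ℚ ⊎ b ≢ 0ℚ
nonzero-difference a b ne with a ≟ℚ 0ℚ | b ≟ℚ 0ℚ
... | no  a≢0  | _        = inj₁ a≢0
... | yes _    | no  b≢0  = inj₂ b≢0
... | yes refl | yes refl = ⊥-elim (ne refl)

α-support : ∀ {n k} (G : Graph n) (M : Vec (Fin n × Fin n) k) → IsInducedMatching G M →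
  ∀ S → α M S ≢ 0ℚ → MatchingFace G M S
α-support {n} G [] _ S α≢0 with emptySimplex-support S α≢0
... | refl = (λ x _ x∈ → ⊥-elim (∉⊥ x∈)) , ∣⊥∣≡0 n , (λ x x∈ → ⊥-elim (∉⊥ x∈))
α-support G ((v , w) ∷ M) induced S α≢0 with nonzero-difference (([ v ]∧ α M) S) (([ w ]∧ α M) S) α≢0
... | inj₁ v-term≢0 = let (v∈S , rest≢0) = wedge-support v (α M) S v-term≢0 in
  extend-face G (v , w) M induced S true v∈S (α-support G M (induced-tail G _ M induced) (S - v) rest≢0)
... | inj₂ w-term≢0 = let (w∈S , rest≢0) = wedge-support w (α M) S w-term≢0 in
  extend-face G (v , w) M induced S false w∈S (α-support G M (induced-tail G _ M induced) (S - w) rest≢0)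

-- Removing from a transversal σ of e ∷ M its endpoint x on e leaves a
-- transversal of M; membership of the endpoints of M is unaffected since they differ from x.

transversal-tail : ∀ {n k} e (M : Vec (Fin n × Fin n) k) σ b → DistinctEndpoints (e ∷ M) →
  IsTransversal (e ∷ M) σ → endpoint (e ∷ M) fz b ∈ σ → endpoint (e ∷ M) fz (not b) ∉ σ →
  IsTransversal M (σ - endpoint (e ∷ M) fz b)
transversal-tail e M σ b distinct (one-each , only-ends) x∈σ x′∉σ = one-each′ , only-ends′
  where
  x : Fin _
  x = endpoint (e ∷ M) fz b
  ≢x : ∀ i c → endpoint M i c ≢ x
  ≢x i c eq with distinct (fs i) fz c b (trans (endpoint-tail e M i c) eq)
  ... | () , _
  keep∈ : ∀ i c → endpoint M i c ∈ σ → endpoint M i c ∈ σ - x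
  keep∈ i c y∈σ = x∈p∧x≢y⇒x∈p-y y∈σ (≢x i c)
  keep∉ : ∀ i c → endpoint M i c ∉ σ → endpoint M i c ∉ σ - x
  keep∉ i c y∉σ y∈σ-x = y∉σ (x∈p-y⇒x∈p y∈σ-x)
  one-each′ : ∀ i → (proj₁ (lookup M i) ∈ σ - x × proj₂ (lookup M i) ∉ σ - x)
                  ⊎ (proj₁ (lookup M i) ∉ σ - x × proj₂ (lookup M i) ∈ σ - x)
  one-each′ i with one-each (fs i)
  ... | inj₁ (v∈ , w∉) = inj₁ (keep∈ i true v∈ , keep∉ i false w∉)
  ... | inj₂ (v∉ , w∈) = inj₂ (keep∉ i true v∉ , keep∈ i false w∈)
  only-ends′ : ∀ y → y ∈ σ - x → ∃ λ i → ∃ λ c → endpoint M i c ≡ y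
  only-ends′ y y∈σ-x with only-ends y (x∈p-y⇒x∈p y∈σ-x)
  ... | fs j , c , eq = j , c , trans (sym (endpoint-tail e M j c)) eq
  ... | fz   , c , refl with c ≟ᵇ b
  ...   | yes refl = ⊥-elim (x∉p-x σ x y∈σ-x)
  ...   | no  c≢b  = ⊥-elim (subst (λ d → endpoint (e ∷ M) fz d ∉ σ) (sym (¬-not c≢b)) x′∉σ (x∈p-y⇒x∈p y∈σ-x))

±1 : ℚ → Set
±1 a = a ≡ 1ℚ ⊎ a ≡ - 1ℚ

±1-neg : ∀ {a} → ±1 a → ±1 (- a)
±1-neg (inj₁ refl) = inj₂ refl
±1-neg (inj₂ refl) = inj₁ refl

±1-sgn : ∀ m → ±1 (sgn m)
±1-sgn zero    = inj₁ refl
±1-sgn (suc m) = ±1-neg (±1-sgn m)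

±1-* : ∀ {a b} → ±1 a → ±1 b → ±1 (a * b)
±1-* {b = b} (inj₁ refl) b±1 = subst ±1 (sym (*-identityˡ b)) b±1
±1-* {b = b} (inj₂ refl) b±1 =
  subst ±1 (trans (cong -_ (sym (*-identityˡ b))) (neg-distribˡ-* 1ℚ b)) (±1-neg b±1)

±1≢0 : ∀ {a} → ±1 a → a ≢ 0ℚ
±1≢0 (inj₁ refl) ()
±1≢0 (inj₂ refl) ()

-- α_M takes the value ±1 on every transversal of M: only the wedge factor of
-- the endpoint in σ survives at each step.

α-on-transversal : ∀ {n k} (M : Vec (Fin n × Fin n) k) σ → DistinctEndpoints M →
  IsTransversal M σ → ±1 (α M σ)
α-on-transversal [] σ _ (_ , only-ends) = inj₁ (emptySimplex-on-empty σ no-vertex)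
  where
  no-vertex : ∀ x → x ∉ σ
  no-vertex x x∈σ with only-ends x x∈σ
  ... | () , _
α-on-transversal ((v , w) ∷ M) σ distinct transversal with proj₁ transversal fz
... | inj₁ (v∈σ , w∉σ) =
  subst ±1 (sym (trans (cong₂ (λ p q → p + - q) (wedge-in v (α M) v∈σ) (wedge-out w (α M) w∉σ)) (+-identityʳ _)))
    (±1-* (±1-sgn (below σ v))
          (α-on-transversal M (σ - v) (distinct-tail _ M distinct)
                            (transversal-tail (v , w) M σ true distinct transversal v∈σ w∉σ)))
... | inj₂ (v∉σ , w∈σ) =
  subst ±1 (sym (trans (cong₂ (λ p q → p + - q) (wedge-out v (α M) v∉σ) (wedge-in w (α M) w∈σ)) (+-identityˡ _)))
    (±1-neg (±1-* (±1-sgn (below σ w))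
                  (α-on-transversal M (σ - w) (distinct-tail _ M distinct)
                                    (transversal-tail (v , w) M σ false distinct transversal w∈σ v∉σ))))

-- A dominating σ gives a cocycle σ^∨ of I(G): a nonzero summand of (δσ^∨)(ρ)
-- needs v ∈ ρ with ρ ∖ v = σ; then v ∉ σ, so v has a neighbour in σ ⊆ ρ.

dominating⇒cocycle : ∀ {n} (G : Graph n) σ → IsDominating G σ →
  ∀ ρ → Independent G ρ → δ (σ ^∨) ρ ≡ 0ℚ
dominating⇒cocycle {n} G σ dominating ρ independent = Σfin-zero n _ summand-zero
  where
  summand-zero : ∀ v → gateOn (lookup ρ v) (sgn (below ρ v)) ((σ ^∨) (ρ - v)) ≡ 0ℚ
  summand-zero v with lookup ρ v in v∈ρ
  ... | false = refl
  ... | true with (σ ^∨) (ρ - v) ≟ℚ 0ℚ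
  ...   | yes σ^∨≡0 = trans (cong (sgn (below ρ v) *_) σ^∨≡0) (*-zeroʳ (sgn (below ρ v)))
  ...   | no  σ^∨≢0 with indicator-support σ (ρ - v) σ^∨≢0 | dominating v
  ...     | ρ-v≡σ | inj₁ v∈σ = ⊥-elim (x∉p-x ρ v (subst (v ∈_) (sym ρ-v≡σ) v∈σ))
  ...     | ρ-v≡σ | inj₂ (y , y∈σ , v~y) =
    ⊥-elim (independent v y (lookup⇒[]= v ρ v∈ρ) (x∈p-y⇒x∈p (subst (y ∈_) (sym ρ-v≡σ) y∈σ)) v~y)

lemma2p2 : ∀ {n k} (G : Graph n) (M : Vec (Fin n × Fin n) k) (σ : Subset n) →
    IsInducedMatching G M → IsTransversal M σ → IsDominating G σ →
    (IsChainOf G k (α M) × IsCycle (α M) × ¬ IsBoundaryIn G k (α M))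
    × (IsChainOf G k (σ ^∨) × IsCocycleIn G k (σ ^∨) × ¬ IsCoboundaryIn G k (σ ^∨))
    × (⟨ σ ^∨ , α M ⟩ ≡ 1ℚ ⊎ ⟨ σ ^∨ , α M ⟩ ≡ - 1ℚ)
lemma2p2 {n} {k} G M σ induced transversal dominating =
    (α-chain , α-cycle M , ¬boundary G k (σ ^∨) (α M) σ-cocycle pairing≢0)
  , (σ-chain , σ-cocycle , ¬coboundary G k (σ ^∨) (α M) α-chain (α-cycle M) pairing≢0)
  , pairing±1
  where
  α-at-σ : ±1 (α M σ)
  α-at-σ = α-on-transversal M σ (proj₁ (proj₂ induced)) transversal
  pairing±1 : ±1 ⟨ σ ^∨ , α M ⟩
  pairing±1 = subst ±1 (sym (indicator-pairing σ (α M))) α-at-σ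
  pairing≢0 : ⟨ σ ^∨ , α M ⟩ ≢ 0ℚ
  pairing≢0 = ±1≢0 pairing±1
  α-chain : IsChainOf G k (α M)
  α-chain S α≢0 = let (independent , size , _) = α-support G M induced S α≢0 in independent , size
  -- σ^∨ is supported on σ, which is a face of α_M because α_M(σ) = ±1.
  σ-chain : IsChainOf G k (σ ^∨)
  σ-chain S σ^∨≢0 rewrite indicator-support σ S σ^∨≢0 = α-chain σ (±1≢0 α-at-σ)
  σ-cocycle : IsCocycleIn G k (σ ^∨)
  σ-cocycle ρ independent _ = dominating⇒cocycle G σ dominating ρ independent
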